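{- Let $k,l,m$ be positive integers and let $\mathcal{H}(k,l,m)=(V(k,l,m),\mathcal{E}_1(k,l,m)\sqcup\mathcal{E}_2(k,l,m)\sqcup\mathcal{E}_3(k,l,m))$ be the multi-hypergraph defined below. In every coloring of $V(k,l,m)$ with the three colors $c_1,c_2,c_3$ there is an index $i\in\{1,2,3\}$ and an edge in $\mathcal{E}_i(k,l,m)$ all of whose vertices have color $c_i$. In particular, $\mathcal{H}(k,l,m)$ has no proper $3$-coloring (i.e., every $3$-coloring of its vertices has a monochromatic edge).
   Context: The multi-hypergraphs $\mathcal{H}(k,l,m)$, for positive integers $k,l,m$, are defined recursively; edge collections are multisets and $\sqcup$ denotes disjoint union. $\mathcal{H}(1,1,1)$ has a single vertex $v$ and $\mathcal{E}_1(1,1,1)=\mathcal{E}_2(1,1,1)=\mathcal{E}_3(1,1,1)=\{\{v\}\}$. If at least one of $k,l,m$ exceeds $1$, take disjoint copies of $\mathcal{H}(k-1,l,m)$, $\mathcal{H}(k,l-1,m)$, $\mathcal{H}(k,l,m-1)$ (a hypergraph with some parameter equal to $0$ is understood to be empty, with no vertices and no edges) and a new vertex $p$, and set $V(k,l,m)=V(k-1,l,m)\sqcup V(k,l-1,m)\sqcup V(k,l,m-1)\sqcup\{p\}$. If $k=1$ then $\mathcal{E}_1(1,l,m)=\{\{u\}: u\in V(1,l,m)\}$; otherwise $\mathcal{E}_1(k,l,m)=\{e\cup\{p\}: e\in\mathcal{E}_1(k-1,l,m)\}\sqcup\mathcal{E}_1(k,l-1,m)\sqcup\mathcal{E}_1(k,l,m-1)$.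 If $l=1$ then $\mathcal{E}_2(k,1,m)=\{\{u\}: u\in V(k,1,m)\}$; otherwise $\mathcal{E}_2(k,l,m)=\{e\cup\{p\}: e\in\mathcal{E}_2(k,l-1,m)\}\sqcup\mathcal{E}_2(k-1,l,m)\sqcup\mathcal{E}_2(k,l,m-1)$. If $m=1$ then $\mathcal{E}_3(k,l,1)=\{\{u\}: u\in V(k,l,1)\}$; otherwise $\mathcal{E}_3(k,l,m)=\{e\cup\{p\}: e\in\mathcal{E}_3(k,l,m-1)\}\sqcup\mathcal{E}_3(k-1,l,m)\sqcup\mathcal{E}_3(k,l-1,m)$. Edges of $\mathcal{E}_1,\mathcal{E}_2,\mathcal{E}_3$ have sizes $k$, $l$, $m$ respectively. -}

module Defs where

open import Data.Nat using (ℕ; zero; suc)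
open import Data.List using (List; []; _∷_; map)

-- A parameter equal to 0 gives the empty type.
-- For k,l,m ≥ 1:  V(k,l,m) = V(k-1,l,m) ⊔ V(k,l-1,m) ⊔ V(k,l,m-1) ⊔ {p}.
-- (For (1,1,1) this is just {p}, the single vertex v.)
data Vtx : ℕ → ℕ → ℕ → Set where
  root : ∀ {k l m} → Vtx (suc k) (suc l) (suc m)
  inK  : ∀ {k l m} → Vtx k (suc l) (suc m) → Vtx (suc k) (suc l) (suc m)
  inL  : ∀ {k l m} → Vtx (suc k) l (suc m) → Vtx (suc k) (suc l) (suc m)
  inM  : ∀ {k l m} → Vtx (suc k) (suc l) m → Vtx (suc k) (suc l) (suc m)

-- Edge multisets, as inductive families of edge labels (one label per copy).
-- E₁ : if k = 1, singletons {u}; otherwise (e ∪ {p}) for e ∈ E₁(k-1,l,m),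
-- plus E₁(k,l-1,m) ⊔ E₁(k,l,m-1).
data E₁ : ℕ → ℕ → ℕ → Set where
  single : ∀ {l m} → Vtx 1 (suc l) (suc m) → E₁ 1 (suc l) (suc m)
  extK   : ∀ {k l m} → E₁ (suc k) (suc l) (suc m) → E₁ (suc (suc k)) (suc l) (suc m)
  inL    : ∀ {k l m} → E₁ (suc (suc k)) l (suc m) → E₁ (suc (suc k)) (suc l) (suc m)
  inM    : ∀ {k l m} → E₁ (suc (suc k)) (suc l) m → E₁ (suc (suc k)) (suc l) (suc m)

data E₂ : ℕ → ℕ → ℕ → Set where
  single : ∀ {k m} → Vtx (suc k) 1 (suc m) → E₂ (suc k) 1 (suc m)
  extL   : ∀ {k l m} → E₂ (suc k) (suc l) (suc m) → E₂ (suc k) (suc (suc l)) (suc m)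
  inK    : ∀ {k l m} → E₂ k (suc (suc l)) (suc m) → E₂ (suc k) (suc (suc l)) (suc m)
  inM    : ∀ {k l m} → E₂ (suc k) (suc (suc l)) m → E₂ (suc k) (suc (suc l)) (suc m)

data E₃ : ℕ → ℕ → ℕ → Set where
  single : ∀ {k l} → Vtx (suc k) (suc l) 1 → E₃ (suc k) (suc l) 1
  extM   : ∀ {k l m} → E₃ (suc k) (suc l) (suc m) → E₃ (suc k) (suc l) (suc (suc m))
  inK    : ∀ {k l m} → E₃ k (suc l) (suc (suc m)) → E₃ (suc k) (suc l) (suc (suc m))
  inL    : ∀ {k l m} → E₃ (suc k) l (suc (suc m)) → E₃ (suc k) (suc l) (suc (suc m))

verts₁ : ∀ {k l m} → E₁ k l m → List (Vtx k l m)
verts₁ (single u) = u ∷ []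
verts₁ (extK e)   = root ∷ map Vtx.inK (verts₁ e)
verts₁ (inL e)    = map Vtx.inL (verts₁ e)
verts₁ (inM e)    = map Vtx.inM (verts₁ e)

verts₂ : ∀ {k l m} → E₂ k l m → List (Vtx k l m)
verts₂ (single u) = u ∷ []
verts₂ (extL e)   = root ∷ map Vtx.inL (verts₂ e)
verts₂ (inK e)    = map Vtx.inK (verts₂ e)
verts₂ (inM e)    = map Vtx.inM (verts₂ e)

verts₃ : ∀ {k l m} → E₃ k l m → List (Vtx k l m)
verts₃ (single u) = u ∷ []
verts₃ (extM e)   = root ∷ map Vtx.inM (verts₃ e)
verts₃ (inK e)    = map Vtx.inK (verts₃ e)
verts₃ (inL e)    = map Vtx.inL (verts₃ e)

-- Induction on k + l + m, looking at the colour c_i of the top vertex p.  If the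
-- i-th parameter is 1, then {p} is itself an edge of E_i.  Otherwise the copy of
-- H with the i-th parameter lowered by one has, by induction, a monochromatic edge
-- of the right colour: if it lies in E_i, adding p gives an edge of E_i coloured
-- c_i; if it lies in E_j with j ≠ i, it is also an edge of E_j of the whole graph.
module Submission where

open import Defs
open import Data.Nat using (ℕ; _≤_; zero; suc)
open import Data.Fin using (Fin)
open import Data.Fin.Patterns using (0F; 1F; 2F)
open import Data.List.Relation.Unary.All using (All; []; _∷_)
open import Data.List.Relation.Unary.All.Properties using (map⁺)
open import Data.Product using (∃; _,_)
open import Data.Sum using (_⊎_; inj₁; inj₂)
open import Function using (_∘_)
open import Relation.Binary.PropositionalEquality using (_≡_)

Edge₁ : ∀ {k l m} → (Vtx k l m → Set) → Set
Edge₁ P = ∃ λ e → All P (verts₁ e)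

Edge₂ : ∀ {k l m} → (Vtx k l m → Set) → Set
Edge₂ P = ∃ λ e → All P (verts₂ e)

Edge₃ : ∀ {k l m} → (Vtx k l m → Set) → Set
Edge₃ P = ∃ λ e → All P (verts₃ e)

Monochromatic : ∀ {k l m} → (Vtx k l m → Fin 3) → Set
Monochromatic c = Edge₁ (λ v → c v ≡ 0F) ⊎ (Edge₂ (λ v → c v ≡ 1F) ⊎ Edge₃ (λ v → c v ≡ 2F))

Edge₂-inK : ∀ {k l m} {P : Vtx (suc (suc k)) (suc l) (suc m) → Set} →
  Edge₂ (P ∘ Vtx.inK) → Edge₂ P
Edge₂-inK (single u , a) = single (Vtx.inK u) , map⁺ a
Edge₂-inK (e@(extL _) , a) = inK e , map⁺ a
Edge₂-inK (e@(inK _) , a) = inK e , map⁺ a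
Edge₂-inK (e@(inM _) , a) = inK e , map⁺ a

Edge₃-inK : ∀ {k l m} {P : Vtx (suc (suc k)) (suc l) (suc m) → Set} →
  Edge₃ (P ∘ Vtx.inK) → Edge₃ P
Edge₃-inK (single u , a) = single (Vtx.inK u) , map⁺ a
Edge₃-inK (e@(extM _) , a) = inK e , map⁺ a
Edge₃-inK (e@(inK _) , a) = inK e , map⁺ a
Edge₃-inK (e@(inL _) , a) = inK e , map⁺ a

Edge₁-inL : ∀ {k l m} {P : Vtx (suc k) (suc (suc l)) (suc m) → Set} →
  Edge₁ (P ∘ Vtx.inL) → Edge₁ P
Edge₁-inL (single u , a) = single (Vtx.inL u) , map⁺ a
Edge₁-inL (e@(extK _) , a) = inL e , map⁺ a
Edge₁-inL (e@(inL _) , a) = inL e , map⁺ a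
Edge₁-inL (e@(inM _) , a) = inL e , map⁺ a

Edge₃-inL : ∀ {k l m} {P : Vtx (suc k) (suc (suc l)) (suc m) → Set} →
  Edge₃ (P ∘ Vtx.inL) → Edge₃ P
Edge₃-inL (single u , a) = single (Vtx.inL u) , map⁺ a
Edge₃-inL (e@(extM _) , a) = inL e , map⁺ a
Edge₃-inL (e@(inK _) , a) = inL e , map⁺ a
Edge₃-inL (e@(inL _) , a) = inL e , map⁺ a

Edge₁-inM : ∀ {k l m} {P : Vtx (suc k) (suc l) (suc (suc m)) → Set} →
  Edge₁ (P ∘ Vtx.inM) → Edge₁ P
Edge₁-inM (single u , a) = single (Vtx.inM u) , map⁺ a
Edge₁-inM (e@(extK _) , a) = inM e , map⁺ a
Edge₁-inM (e@(inL _) , a) = inM e , map⁺ a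
Edge₁-inM (e@(inM _) , a) = inM e , map⁺ a

Edge₂-inM : ∀ {k l m} {P : Vtx (suc k) (suc l) (suc (suc m)) → Set} →
  Edge₂ (P ∘ Vtx.inM) → Edge₂ P
Edge₂-inM (single u , a) = single (Vtx.inM u) , map⁺ a
Edge₂-inM (e@(extL _) , a) = inM e , map⁺ a
Edge₂-inM (e@(inK _) , a) = inM e , map⁺ a
Edge₂-inM (e@(inM _) , a) = inM e , map⁺ a

Edge₁-extK : ∀ {k l m} {P : Vtx (suc (suc k)) (suc l) (suc m) → Set} →
  P root → Edge₁ (P ∘ Vtx.inK) → Edge₁ P
Edge₁-extK p (e , a) = extK e , p ∷ map⁺ a

Edge₂-extL : ∀ {k l m} {P : Vtx (suc k) (suc (suc l)) (suc m) → Set} →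
  P root → Edge₂ (P ∘ Vtx.inL) → Edge₂ P
Edge₂-extL p (e , a) = extL e , p ∷ map⁺ a

Edge₃-extM : ∀ {k l m} {P : Vtx (suc k) (suc l) (suc (suc m)) → Set} →
  P root → Edge₃ (P ∘ Vtx.inM) → Edge₃ P
Edge₃-extM p (e , a) = extM e , p ∷ map⁺ a

Monochromatic-inK : ∀ {k l m} {c : Vtx (suc (suc k)) (suc l) (suc m) → Fin 3} →
  c root ≡ 0F → Monochromatic (c ∘ Vtx.inK) → Monochromatic c
Monochromatic-inK p (inj₁ e) = inj₁ (Edge₁-extK p e)
Monochromatic-inK p (inj₂ (inj₁ e)) = inj₂ (inj₁ (Edge₂-inK e))
Monochromatic-inK p (inj₂ (inj₂ e)) = inj₂ (inj₂ (Edge₃-inK e))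

Monochromatic-inL : ∀ {k l m} {c : Vtx (suc k) (suc (suc l)) (suc m) → Fin 3} →
  c root ≡ 1F → Monochromatic (c ∘ Vtx.inL) → Monochromatic c
Monochromatic-inL p (inj₁ e) = inj₁ (Edge₁-inL e)
Monochromatic-inL p (inj₂ (inj₁ e)) = inj₂ (inj₁ (Edge₂-extL p e))
Monochromatic-inL p (inj₂ (inj₂ e)) = inj₂ (inj₂ (Edge₃-inL e))

Monochromatic-inM : ∀ {k l m} {c : Vtx (suc k) (suc l) (suc (suc m)) → Fin 3} →
  c root ≡ 2F → Monochromatic (c ∘ Vtx.inM) → Monochromatic c
Monochromatic-inM p (inj₁ e) = inj₁ (Edge₁-inM e)
Monochromatic-inM p (inj₂ (inj₁ e)) = inj₂ (inj₁ (Edge₂-inM e))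
Monochromatic-inM p (inj₂ (inj₂ e)) = inj₂ (inj₂ (Edge₃-extM p e))

monochromatic : ∀ k l m (c : Vtx (suc k) (suc l) (suc m) → Fin 3) → Monochromatic c
monochromatic-root₁ : ∀ k l m (c : Vtx (suc k) (suc l) (suc m) → Fin 3) →
  c root ≡ 0F → Monochromatic c
monochromatic-root₂ : ∀ k l m (c : Vtx (suc k) (suc l) (suc m) → Fin 3) →
  c root ≡ 1F → Monochromatic c
monochromatic-root₃ : ∀ k l m (c : Vtx (suc k) (suc l) (suc m) → Fin 3) →
  c root ≡ 2F → Monochromatic c

monochromatic k l m c with c root in p
... | 0F = monochromatic-root₁ k l m c p
... | 1F = monochromatic-root₂ k l m c p
... | 2F = monochromatic-root₃ k l m c p

monochromatic-root₁ zero l m c p = inj₁ (single root , p ∷ [])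
monochromatic-root₁ (suc k) l m c p =
  Monochromatic-inK p (monochromatic k l m (c ∘ Vtx.inK))

monochromatic-root₂ k zero m c p = inj₂ (inj₁ (single root , p ∷ []))
monochromatic-root₂ k (suc l) m c p =
  Monochromatic-inL p (monochromatic k l m (c ∘ Vtx.inL))

monochromatic-root₃ k l zero c p = inj₂ (inj₂ (single root , p ∷ []))
monochromatic-root₃ k l (suc m) c p =
  Monochromatic-inM p (monochromatic k l m (c ∘ Vtx.inM))

lemma16 : (k l m : ℕ) → 1 ≤ k → 1 ≤ l → 1 ≤ m →
    (c : Vtx k l m → Fin 3) →
      (∃ λ (e : E₁ k l m) → All (λ v → c v ≡ 0F) (verts₁ e))
      ⊎ ((∃ λ (e : E₂ k l m) → All (λ v → c v ≡ 1F) (verts₂ e))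
      ⊎ (∃ λ (e : E₃ k l m) → All (λ v → c v ≡ 2F) (verts₃ e)))
lemma16 (suc k) (suc l) (suc m) _ _ _ = monochromatic k l m
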